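{- Let $G$ and $H$ be graphs such that $G$ does not admit an immersion (respectively, a strong immersion) of $H$. Suppose there exist $u,v\in V(G)$ joined by at least $|E(H)|$ parallel edges in $G$, and let $G'$ be obtained from $G$ by consolidating $\{u,v\}$. Then $G'$ does not admit an immersion (respectively, a strong immersion) of $H$.
   Context: Graphs may have parallel edges but no loops. Consolidating a set $X\subseteq V(G)$ means deleting all edges with both ends in $X$ and identifying $X$ to a single vertex. $G$ admits a (weak) immersion of $H$ if there is an injective map $\pi:V(H)\to V(G)$ and, for each edge $f=xy$ of $H$, a path $\pi(f)$ in $G$ between $\pi(x)$ and $\pi(y)$, these paths pairwise edge-disjoint; it is a strong immersion if moreover no $\pi(w)$, $w\in V(H)$, is an internal vertex of any $\pi(f)$. -}

module Defs where

open import Data.Nat using (ℕ; zero; suc; pred)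
open import Data.Fin using (Fin; zero; suc; _≟_; punchOut)
open import Data.Product using (Σ; _×_; _,_; proj₁; proj₂)
open import Data.Sum using (_⊎_)
open import Data.List using (List; []; _∷_; length; lookup; filter; allFin)
open import Data.List.Membership.Propositional using (_∈_; _∉_)
open import Data.List.Relation.Unary.Unique.Propositional using (Unique)
open import Relation.Nullary using (¬_; yes; no; ¬?)
open import Relation.Nullary.Decidable using (_⊎-dec_; _×-dec_)
open import Relation.Binary.PropositionalEquality using (_≡_; _≢_; sym)
open import Function.Definitions using (Injective)

record Graph : Set where
  field
    nV   : ℕ
    nE   : ℕ
    ends : Fin nE → Fin nV × Fin nV
open Graph public

Loopless : Graph → Set
Loopless G = ∀ e → proj₁ (ends G e) ≢ proj₂ (ends G e)

Joins : (G : Graph) → Fin (nE G) → Fin (nV G) → Fin (nV G) → Set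
Joins G e a b = (ends G e ≡ (a , b)) ⊎ (ends G e ≡ (b , a))

data Walk (G : Graph) : Fin (nV G) → Fin (nV G) → Set where
  nil  : ∀ a → Walk G a a
  step : ∀ {a x b} (e : Fin (nE G)) → Joins G e a x → Walk G x b → Walk G a b

module _ {G : Graph} where
  verts : ∀ {a b} → Walk G a b → List (Fin (nV G))
  verts (nil a) = a ∷ []
  verts (step {a} e _ w) = a ∷ verts w

  edgesOf : ∀ {a b} → Walk G a b → List (Fin (nE G))
  edgesOf (nil a) = []
  edgesOf (step e _ w) = e ∷ edgesOf w

  initVerts : ∀ {a b} → Walk G a b → List (Fin (nV G))
  initVerts (nil a) = []
  initVerts (step {a} e _ w) = a ∷ initVerts w

  interior : ∀ {a b} → Walk G a b → List (Fin (nV G))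
  interior (nil a) = []
  interior (step e _ w) = initVerts w

  IsPath : ∀ {a b} → Walk G a b → Set
  IsPath w = Unique (verts w)

EdgeDisjoint : (G : Graph) {a b c d : Fin (nV G)} → Walk G a b → Walk G c d → Set
EdgeDisjoint G p q = ∀ e → e ∈ edgesOf p → e ∉ edgesOf q

record Immersion (G H : Graph) : Set where
  field
    π      : Fin (nV H) → Fin (nV G)
    π-inj  : Injective _≡_ _≡_ π
    ρ      : (f : Fin (nE H)) → Walk G (π (proj₁ (ends H f))) (π (proj₂ (ends H f)))
    ρ-path : ∀ f → IsPath (ρ f)
    ρ-disj : ∀ f f′ → f ≢ f′ → EdgeDisjoint G (ρ f) (ρ f′)

record StrongImmersion (G H : Graph) : Set where
  field
    imm    : Immersion G H
    strong : ∀ (w : Fin (nV H)) (f : Fin (nE H)) →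
             Immersion.π imm w ∉ interior (Immersion.ρ imm f)

ParallelAtLeast : (G : Graph) → Fin (nV G) → Fin (nV G) → ℕ → Set
ParallelAtLeast G u v m =
  Σ (Fin m → Fin (nE G)) λ ι → Injective _≡_ _≡_ ι × (∀ i → Joins G (ι i) u v)

-- vertex map for identifying v with u (vertex set Fin n ↦ Fin (pred n))
shrink : ∀ {n} (u v : Fin n) → u ≢ v → Fin n → Fin (pred n)
shrink {suc n} u v neq w with w ≟ v
... | yes _ = punchOut {i = v} {j = u} (λ eq → neq (sym eq))
... | no ne = punchOut {i = v} {j = w} (λ eq → ne (sym eq))

InUV : ∀ {n} → Fin n → Fin n → Fin n → Set
InUV u v x = (x ≡ u) ⊎ (x ≡ v)

keptEdges : (G : Graph) (u v : Fin (nV G)) → List (Fin (nE G))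
keptEdges G u v =
  filter (λ e → ¬? (((proj₁ (ends G e) ≟ u) ⊎-dec (proj₁ (ends G e) ≟ v))
                ×-dec ((proj₂ (ends G e) ≟ u) ⊎-dec (proj₂ (ends G e) ≟ v))))
         (allFin (nE G))

-- consolidating {u,v}: delete edges inside {u,v}, identify u and v
consolidate : (G : Graph) (u v : Fin (nV G)) → u ≢ v → Graph
consolidate G u v neq = record
  { nV   = pred (nV G)
  ; nE   = length (keptEdges G u v)
  ; ends = λ i → let e = lookup (keptEdges G u v) i in
                 shrink u v neq (proj₁ (ends G e)) , shrink u v neq (proj₂ (ends G e))
  }

-- Given an immersion of H in the consolidation G′, pull it back along the
-- vertex map punchIn v, which never hits v. Each path is lifted edge by edge;
-- wherever two consecutive lifted edges meet the pair {u, v} at different ends,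
-- one of the parallel u–v edges is spliced in, a different one for each edge
-- of H. The spliced edges are deleted in G′, so edge-disjointness survives;
-- shrinking identifies only u and v, so the lifted walks are still paths; and
-- the only new interior vertex is v, which is not a branch vertex.
module Submission where

open import Defs
open import Data.Fin using (Fin)
open import Data.Product using (_×_)
open import Relation.Nullary using (¬_)
open import Relation.Binary.PropositionalEquality using (_≢_)

open import Data.Nat using (ℕ; suc)
open import Data.Fin using (zero; suc; _≟_; punchIn)
open import Data.Fin.Properties
  using (punchInᵢ≢i; punchIn-injective; punchOut-injective; punchOut-cong; punchOut-punchIn)
open import Data.Product using (_,_; proj₁; proj₂; ∃-syntax)
open import Data.Sum using (_⊎_; inj₁; inj₂; swap)
open import Data.Empty using (⊥-elim)
open import Data.List using (List; _∷_; lookup; allFin)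
open import Data.List.Membership.Propositional using (_∈_; _∉_)
open import Data.List.Membership.Propositional.Properties using (∈-filter⁻; ∈-lookup)
open import Data.List.Relation.Unary.Any using (here; there)
open import Data.List.Relation.Unary.All as All using ()
open import Data.List.Relation.Unary.All.Properties using (All¬⇒¬Any; ¬Any⇒All¬)
open import Data.List.Relation.Unary.AllPairs using ([]; _∷_)
open import Data.List.Relation.Unary.Unique.Propositional using (Unique)
open import Data.List.Relation.Unary.Unique.Propositional.Properties using (allFin⁺; filter⁺)
open import Relation.Nullary using (yes; no)
open import Relation.Binary.PropositionalEquality using (_≡_; refl; sym; trans; cong; subst)
open import Function using (_∘_; id)

lookup-injective : ∀ {A : Set} {xs : List A} → Unique xs →
                   ∀ {i j} → lookup xs i ≡ lookup xs j → i ≡ j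
lookup-injective (_ ∷ _)       {zero}  {zero}  _  = refl
lookup-injective (x∉xs ∷ _)    {zero}  {suc j} eq = ⊥-elim (All.lookup x∉xs (∈-lookup j) eq)
lookup-injective (x∉xs ∷ _)    {suc i} {zero}  eq = ⊥-elim (All.lookup x∉xs (∈-lookup i) (sym eq))
lookup-injective (_ ∷ unique)  {suc i} {suc j} eq = cong suc (lookup-injective unique eq)

joins-swap : ∀ {G g u v a c} → (a ≡ u × c ≡ v) ⊎ (a ≡ v × c ≡ u) →
             Joins G g u v → Joins G g a c
joins-swap (inj₁ (refl , refl)) = id
joins-swap (inj₂ (refl , refl)) = swap

module _ {n} {u v : Fin (suc n)} (u≢v : u ≢ v) where

  shrink-punchIn : ∀ y → shrink u v u≢v (punchIn v y) ≡ y
  shrink-punchIn y with punchIn v y ≟ v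
  ... | yes punchIn≡v = ⊥-elim (punchInᵢ≢i v y punchIn≡v)
  ... | no  _         = trans (punchOut-cong v refl) (punchOut-punchIn v)

  shrink-identifies-only-u-v : ∀ {a c} → a ≢ c → shrink u v u≢v a ≡ shrink u v u≢v c →
                               (a ≡ u × c ≡ v) ⊎ (a ≡ v × c ≡ u)
  shrink-identifies-only-u-v {a} {c} a≢c eq with a ≟ v | c ≟ v
  ... | yes a≡v | yes c≡v = ⊥-elim (a≢c (trans a≡v (sym c≡v)))
  ... | yes a≡v | no  c≢v = inj₂ (a≡v , sym (punchOut-injective {i = v} (u≢v ∘ sym) (c≢v ∘ sym) eq))
  ... | no  a≢v | yes c≡v = inj₁ (punchOut-injective {i = v} (a≢v ∘ sym) (u≢v ∘ sym) eq , c≡v)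
  ... | no  a≢v | no  c≢v = ⊥-elim (a≢c (punchOut-injective {i = v} (a≢v ∘ sym) (c≢v ∘ sym) eq))

  shrink-partner≡v : ∀ {a c} → a ≢ c → shrink u v u≢v a ≡ shrink u v u≢v c → c ≢ v → a ≡ v
  shrink-partner≡v a≢c eq c≢v with shrink-identifies-only-u-v a≢c eq
  ... | inj₁ (_ , c≡v) = ⊥-elim (c≢v c≡v)
  ... | inj₂ (a≡v , _) = a≡v

module _ (G : Graph) (u v : Fin (nV G)) where

  keptEdges-unique : Unique (keptEdges G u v)
  keptEdges-unique = filter⁺ _ (allFin⁺ (nE G))

  joining-∉-keptEdges : ∀ {g} → Joins G g u v → g ∉ keptEdges G u v
  joining-∉-keptEdges g-uv g∈ with proj₂ (∈-filter⁻ _ {xs = allFin (nE G)} g∈) | g-uv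
  ... | not-inside | inj₁ ends≡ = not-inside (inj₁ (cong proj₁ ends≡) , inj₂ (cong proj₂ ends≡))
  ... | not-inside | inj₂ ends≡ = not-inside (inj₂ (cong proj₁ ends≡) , inj₁ (cong proj₂ ends≡))

module Unconsolidate {m k : ℕ} (endpoints : Fin k → Fin (suc m) × Fin (suc m))
                     {u v : Fin (suc m)} (u≢v : u ≢ v) where

  G : Graph
  G = record { nV = suc m ; nE = k ; ends = endpoints }

  G′ : Graph
  G′ = consolidate G u v u≢v

  private
    sh : Fin (suc m) → Fin m
    sh = shrink u v u≢v

    lift : Fin m → Fin (suc m)
    lift = punchIn v

    edge : Fin (nE G′) → Fin k
    edge = lookup (keptEdges G u v)

  edge-not-joining : ∀ {g} → Joins G g u v → ∀ e′ → edge e′ ≢ g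
  edge-not-joining g-uv e′ refl = joining-∉-keptEdges G u v g-uv (∈-lookup e′)

  record EdgeLift (e′ : Fin (nE G′)) (a′ b′ : Fin m) : Set where
    field
      start end : Fin (suc m)
      start↦    : sh start ≡ a′
      end↦      : sh end ≡ b′
      joins     : Joins G (edge e′) start end

  liftJoins : ∀ {e′ a′ b′} → Joins G′ e′ a′ b′ → EdgeLift e′ a′ b′
  liftJoins {e′} (inj₁ ends≡) = record
    { start = proj₁ (endpoints (edge e′)) ; end = proj₂ (endpoints (edge e′))
    ; start↦ = cong proj₁ ends≡ ; end↦ = cong proj₂ ends≡ ; joins = inj₁ refl }
  liftJoins {e′} (inj₂ ends≡) = record
    { start = proj₂ (endpoints (edge e′)) ; end = proj₁ (endpoints (edge e′))
    ; start↦ = cong proj₂ ends≡ ; end↦ = cong proj₁ ends≡ ; joins = inj₂ refl }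

  module WithBridge {g : Fin k} (g-uv : Joins G g u v) where

    splice : ∀ {b} a c → sh a ≡ sh c → Walk G c b → Walk G a b
    splice a c same w with a ≟ c
    ... | yes refl = w
    ... | no  a≢c  = step g (joins-swap {G = G} (shrink-identifies-only-u-v u≢v a≢c same) g-uv) w

    splice-verts : ∀ {b} a c same (w : Walk G c b) {z} →
                z ∈ verts (splice a c same w) → z ≡ a ⊎ z ∈ verts w
    splice-verts a c same w z∈ with a ≟ c
    ... | yes refl = inj₂ z∈
    splice-verts a c same w (here z≡a)  | no _ = inj₁ z≡a
    splice-verts a c same w (there z∈w) | no _ = inj₂ z∈w

    splice-initVerts : ∀ {b} a c same (w : Walk G c b) {z} →
                    z ∈ initVerts (splice a c same w) → (a ≢ c × z ≡ a) ⊎ z ∈ initVerts w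
    splice-initVerts a c same w z∈ with a ≟ c
    ... | yes refl = inj₂ z∈
    splice-initVerts a c same w (here z≡a)  | no a≢c = inj₁ (a≢c , z≡a)
    splice-initVerts a c same w (there z∈w) | no _   = inj₂ z∈w

    splice-interior : ∀ {b} a c same (w : Walk G c b) {z} →
                   z ∈ interior (splice a c same w) → z ∈ interior w ⊎ (a ≢ c × z ∈ initVerts w)
    splice-interior a c same w z∈ with a ≟ c
    ... | yes refl = inj₁ z∈
    ... | no  a≢c  = inj₂ (a≢c , z∈)

    splice-edges : ∀ {b} a c same (w : Walk G c b) {e} →
                e ∈ edgesOf (splice a c same w) → e ≡ g ⊎ e ∈ edgesOf w
    splice-edges a c same w e∈ with a ≟ c
    ... | yes refl = inj₂ e∈
    splice-edges a c same w (here e≡g)  | no _ = inj₁ e≡g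
    splice-edges a c same w (there e∈w) | no _ = inj₂ e∈w

    splice-isPath : ∀ {b} a c same (w : Walk G c b) →
                 (a ≢ c → a ∉ verts w) → IsPath w → IsPath (splice a c same w)
    splice-isPath a c same w a∉w w-path with a ≟ c
    ... | yes refl = w-path
    ... | no  a≢c  = ¬Any⇒All¬ _ (a∉w a≢c) ∷ w-path

    liftWalk : ∀ {a′ b′} a → sh a ≡ a′ → Walk G′ a′ b′ → Walk G a (lift b′)
    liftWalk a a↦ (nil a′) = splice a (lift a′) (trans a↦ (sym (shrink-punchIn u≢v a′))) (nil _)
    liftWalk a a↦ (step e′ j w) =
      splice a start (trans a↦ (sym start↦)) (step (edge e′) joins (liftWalk end end↦ w))
      where open EdgeLift (liftJoins j)

    liftWalk-verts : ∀ {a′ b′} a a↦ (w : Walk G′ a′ b′) {z} →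
                     z ∈ verts (liftWalk a a↦ w) → sh z ∈ verts w
    liftWalk-verts a a↦ (nil a′) z∈ with splice-verts a _ _ (nil _) z∈
    ... | inj₁ refl        = here a↦
    ... | inj₂ (here refl) = here (shrink-punchIn u≢v a′)
    liftWalk-verts a a↦ (step e′ j w) z∈ with splice-verts a _ _ _ z∈
    ... | inj₁ refl          = here a↦
    ... | inj₂ (here refl)   = here (EdgeLift.start↦ (liftJoins j))
    ... | inj₂ (there z∈rest) = there (liftWalk-verts _ _ w z∈rest)

    liftWalk-isPath : ∀ {a′ b′} a a↦ (w : Walk G′ a′ b′) → IsPath w → IsPath (liftWalk a a↦ w)
    liftWalk-isPath a a↦ (nil a′) _ =
      splice-isPath a _ _ (nil _) (λ { a≢c (here a≡c) → a≢c a≡c }) (All.[] ∷ [])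
    liftWalk-isPath a a↦ (step e′ j w) (a′∉w ∷ w-path) =
      splice-isPath a start _ _ a∉ (¬Any⇒All¬ _ (over-a′-∉ start start↦) ∷ liftWalk-isPath end end↦ w w-path)
      where
        open EdgeLift (liftJoins j)
        over-a′-∉ : ∀ x → sh x ≡ _ → x ∉ verts (liftWalk end end↦ w)
        over-a′-∉ x x↦ x∈ = All¬⇒¬Any a′∉w (subst (_∈ verts w) x↦ (liftWalk-verts end end↦ w x∈))
        a∉ : a ≢ start → a ∉ start ∷ verts (liftWalk end end↦ w)
        a∉ a≢start (here a≡start) = a≢start a≡start
        a∉ _       (there a∈)     = over-a′-∉ a a↦ a∈

    liftWalk-edges : ∀ {a′ b′} a a↦ (w : Walk G′ a′ b′) {e} → e ∈ edgesOf (liftWalk a a↦ w) →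
                     e ≡ g ⊎ ∃[ e′ ] e′ ∈ edgesOf w × e ≡ edge e′
    liftWalk-edges a a↦ (nil a′) e∈ with splice-edges a _ _ (nil _) e∈
    ... | inj₁ e≡g = inj₁ e≡g
    liftWalk-edges a a↦ (step e′ j w) e∈ with splice-edges a _ _ _ e∈
    ... | inj₁ e≡g          = inj₁ e≡g
    ... | inj₂ (here e≡e′)  = inj₂ (e′ , here refl , e≡e′)
    ... | inj₂ (there e∈rest) with liftWalk-edges _ _ w e∈rest
    ...   | inj₁ e≡g             = inj₁ e≡g
    ...   | inj₂ (e″ , e″∈ , e≡) = inj₂ (e″ , there e″∈ , e≡)

    liftWalk-initVerts : ∀ {a′ b′} a a↦ (w : Walk G′ a′ b′) {z} →
                         z ∈ initVerts (liftWalk a a↦ w) → sh z ∈ initVerts w ⊎ z ≡ v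
    liftWalk-initVerts a a↦ (nil a′) z∈ with splice-initVerts a _ _ (nil _) z∈
    ... | inj₁ (a≢c , refl) =
      inj₂ (shrink-partner≡v u≢v a≢c (trans a↦ (sym (shrink-punchIn u≢v a′))) (punchInᵢ≢i v a′))
    liftWalk-initVerts a a↦ (step e′ j w) z∈ with splice-initVerts a _ _ _ z∈
    ... | inj₁ (_ , refl)    = inj₁ (here a↦)
    ... | inj₂ (here refl)   = inj₁ (here (EdgeLift.start↦ (liftJoins j)))
    ... | inj₂ (there z∈rest) with liftWalk-initVerts _ _ w z∈rest
    ...   | inj₁ sh-z∈ = inj₁ (there sh-z∈)
    ...   | inj₂ z≡v   = inj₂ z≡v

    liftWalk-interior : ∀ {a′ b′} (w : Walk G′ a′ b′) {z} →
                        z ∈ interior (liftWalk (lift a′) (shrink-punchIn u≢v a′) w) →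
                        sh z ∈ interior w ⊎ z ≡ v
    liftWalk-interior (nil a′) z∈ with splice-interior (lift a′) _ _ (nil _) z∈
    ... | inj₁ ()
    ... | inj₂ (_ , ())
    liftWalk-interior {a′} (step e′ j w) z∈ with splice-interior (lift a′) _ _ _ z∈
    ... | inj₁ z∈rest                = liftWalk-initVerts _ _ w z∈rest
    ... | inj₂ (_ , there z∈rest)    = liftWalk-initVerts _ _ w z∈rest
    ... | inj₂ (a≢start , here refl) =
      inj₂ (shrink-partner≡v u≢v (a≢start ∘ sym)
              (trans (EdgeLift.start↦ (liftJoins j)) (sym (shrink-punchIn u≢v a′)))
              (punchInᵢ≢i v a′))

  module _ {H : Graph} (parallel : ParallelAtLeast G u v (nE H)) where

    private
      bridge : Fin (nE H) → Fin k
      bridge = proj₁ parallel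

      bridge-joins : ∀ f → Joins G (bridge f) u v
      bridge-joins = proj₂ (proj₂ parallel)

    module _ (I : Immersion G′ H) where
      open Immersion I

      liftPath : ∀ f → Walk G (lift (π (proj₁ (ends H f)))) (lift (π (proj₂ (ends H f))))
      liftPath f = WithBridge.liftWalk (bridge-joins f) _ (shrink-punchIn u≢v _) (ρ f)

      liftPath-disjoint : ∀ f f′ → f ≢ f′ → EdgeDisjoint G (liftPath f) (liftPath f′)
      liftPath-disjoint f f′ f≢f′ e e∈ e∈′
        with WithBridge.liftWalk-edges (bridge-joins f)  _ _ (ρ f)  e∈
           | WithBridge.liftWalk-edges (bridge-joins f′) _ _ (ρ f′) e∈′
      ... | inj₁ e≡ | inj₁ e≡′ = f≢f′ (proj₁ (proj₂ parallel) (trans (sym e≡) e≡′))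
      ... | inj₁ e≡ | inj₂ (e₂ , _ , e≡′) = edge-not-joining (bridge-joins f) e₂ (trans (sym e≡′) e≡)
      ... | inj₂ (e₁ , _ , e≡) | inj₁ e≡′ = edge-not-joining (bridge-joins f′) e₁ (trans (sym e≡) e≡′)
      ... | inj₂ (e₁ , e₁∈ , e≡) | inj₂ (e₂ , e₂∈ , e≡′)
        with lookup-injective (keptEdges-unique G u v) (trans (sym e≡) e≡′)
      ...   | refl = ρ-disj f f′ f≢f′ e₁ e₁∈ e₂∈

      liftImmersion : Immersion G H
      liftImmersion = record
        { π      = lift ∘ π
        ; π-inj  = π-inj ∘ punchIn-injective v _ _
        ; ρ      = liftPath
        ; ρ-path = λ f → WithBridge.liftWalk-isPath (bridge-joins f) _ _ (ρ f) (ρ-path f)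
        ; ρ-disj = liftPath-disjoint
        }

    liftStrongImmersion : StrongImmersion G′ H → StrongImmersion G H
    liftStrongImmersion S = record { imm = liftImmersion imm ; strong = branch-∉-interior }
      where
        open StrongImmersion S
        open Immersion imm
        branch-∉-interior : ∀ x f → lift (π x) ∉ interior (liftPath imm f)
        branch-∉-interior x f z∈ with WithBridge.liftWalk-interior (bridge-joins f) (ρ f) z∈
        ... | inj₁ sh-z∈ = strong x f (subst (_∈ interior (ρ f)) (shrink-punchIn u≢v (π x)) sh-z∈)
        ... | inj₂ z≡v   = punchInᵢ≢i v (π x) z≡v

mainTheorem13 : (G H : Graph) → Loopless G → Loopless H →
    (u v : Fin (nV G)) (neq : u ≢ v) → ParallelAtLeast G u v (nE H) →
    (¬ Immersion G H → ¬ Immersion (consolidate G u v neq) H)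
    × (¬ StrongImmersion G H → ¬ StrongImmersion (consolidate G u v neq) H)
mainTheorem13 record { nV = suc m ; ends = endpoints } H _ _ u v neq parallel =
  (λ ¬imm imm′ → ¬imm (liftImmersion parallel imm′)) ,
  (λ ¬strong strong′ → ¬strong (liftStrongImmersion parallel strong′))
  where open Unconsolidate endpoints neq
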